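{- Let $g$ be a positive integer and $k\le\lfloor g/2\rfloor$ a nonnegative integer. Let $G=(L\cup R,E)$ be a $g$-bicycle-free bipartite graph with $n=|L|+|R|$ vertices and $|E|=m$ edges. Then there are at least $k(m-n)$ simple paths of length at most $2k$ that start at a vertex of $L$ and end at a vertex of $L$.
   Context: A graph $G$ is $r$-bicycle-free if for every vertex $v$, the subgraph induced on the set of vertices at distance at most $r$ from $v$ contains at most one cycle. The length of a path is its number of edges. -}

module Defs where

open import Data.Nat using (ℕ; zero; suc; _+_; _*_; _≤_; _<ᵇ_)
open import Data.Bool using (Bool; true; false; T; _∧_; if_then_else_; not)
open import Data.Fin using (Fin; toℕ)
open import Data.List using (List; []; _∷_; length; map; allFin)
open import Data.Nat.ListAction using (sum)
open import Data.List.Relation.Unary.All using (All)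
open import Data.List.Relation.Unary.Linked using (Linked)
open import Data.List.Relation.Unary.Unique.Propositional using (Unique)
open import Data.List.Membership.Propositional using (_∈_)
open import Data.Product using (_×_; _,_)
open import Data.Sum using (_⊎_)
open import Data.Empty using (⊥)
open import Relation.Binary.PropositionalEquality using (_≡_)
open import Function.Bundles using (_⇔_)

record Graph (n : ℕ) : Set where
  field
    adj   : Fin n → Fin n → Bool
    sym   : ∀ i j → adj i j ≡ adj j i
    irrefl : ∀ i → adj i i ≡ false

module _ {n : ℕ} (G : Graph n) where
  open Graph G

  Adj : Fin n → Fin n → Set
  Adj i j = T (adj i j)

  edgeCount : ℕ
  edgeCount = sum (map (λ i → sum (map (λ j →
                 if adj i j ∧ (toℕ i <ᵇ toℕ j) then 1 else 0) (allFin n))) (allFin n))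

  -- bipartition (L ∪ R): side v = true means v ∈ L, false means v ∈ R;
  -- every edge joins L and R.
  IsBipartition : (Fin n → Bool) → Set
  IsBipartition side = ∀ i j → Adj i j → side i ≡ not (side j)

  data Within : ℕ → Fin n → Fin n → Set where
    here  : ∀ {r v} → Within r v v
    step  : ∀ {r v w u} → Within r v w → Adj w u → Within (suc r) v u

  lastOf : Fin n → List (Fin n) → Fin n
  lastOf x []       = x
  lastOf x (y ∷ ys) = lastOf y ys

  pathEdges : List (Fin n) → List (Fin n × Fin n)
  pathEdges []           = []
  pathEdges (x ∷ [])     = []
  pathEdges (x ∷ y ∷ ys) = (x , y) ∷ pathEdges (y ∷ ys)

  cycleEdges : List (Fin n) → List (Fin n × Fin n)
  cycleEdges []       = []
  cycleEdges (x ∷ xs) = (lastOf x xs , x) ∷ pathEdges (x ∷ xs)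

  IsCycle : List (Fin n) → Set
  IsCycle []       = ⊥
  IsCycle (x ∷ xs) = 3 ≤ length (x ∷ xs) × Unique (x ∷ xs)
                     × Linked Adj (x ∷ xs) × Adj (lastOf x xs) x

  UsesEdge : List (Fin n) → Fin n → Fin n → Set
  UsesEdge c i j = ((i , j) ∈ cycleEdges c) ⊎ ((j , i) ∈ cycleEdges c)

  -- two cycle representations are the same cycle (subgraph) iff same edge set
  SameCycle : List (Fin n) → List (Fin n) → Set
  SameCycle c d = ∀ i j → UsesEdge c i j ⇔ UsesEdge d i j

  -- r-bicycle-free: for every vertex v, the subgraph induced on the ball of
  -- radius r around v contains at most one cycle, i.e. any two cycles all of
  -- whose vertices lie in the ball are the same cycle.
  BicycleFree : ℕ → Set
  BicycleFree r = ∀ v (c d : List (Fin n))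
                  → IsCycle c → All (Within r v) c
                  → IsCycle d → All (Within r v) d
                  → SameCycle c d

  -- endpoint condition for a path x ∷ xs: starts and ends in L, and is
  -- written in its canonical orientation (toℕ start ≤ toℕ end), so that each
  -- undirected path is represented by exactly one vertex list.
  EndsInL : (Fin n → Bool) → List (Fin n) → Set
  EndsInL side []       = ⊥
  EndsInL side (x ∷ xs) = T (side x) × T (side (lastOf x xs))
                          × toℕ x ≤ toℕ (lastOf x xs)

  -- simple path of length (number of edges) at most ℓ from L to L
  IsLLPath : (Fin n → Bool) → ℕ → List (Fin n) → Set
  IsLLPath side ℓ p = Unique p × Linked Adj p × length p ≤ suc ℓ × EndsInL side p

{-# OPTIONS --safe #-}
module Submission where

-- Induction on the number m of edges; for m ≤ n there is nothing to show. If m > n, then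
-- G contains a path with more than g edges: deleting the edge at a leaf lowers both m and the
-- number of non-isolated vertices; if all degrees are at most 2, the handshake lemma bounds m
-- by the number of non-isolated vertices; otherwise a path grown as long as possible through
-- a vertex of degree at least 3 in a leafless graph cannot stop within g edges, since chords at
-- both of its ends would close two different cycles within distance g of one end.
-- Start that path at y₀ ∈ L. Its prefixes with 2, 4, …, 2k edges are k L–L paths through
-- the edge y₀y₁, so they are new compared with the k(m − 1 − n) L–L paths of G − y₀y₁
-- provided by induction.

open import Defs
open import Data.Bool using (Bool; true; false; T; _∧_; _∨_; not; if_then_else_)
open import Data.Bool.Properties using (∧-comm; ∨-comm; ∧-identityʳ; ∧-zeroʳ; T?; T-≡; T-∧; not-involutive)
open import Data.Empty using (⊥; ⊥-elim)
open import Data.Fin using (Fin; zero; suc; toℕ; punchIn)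
open import Data.Fin.Properties using (_≟_; punchInᵢ≢i; toℕ-injective; any?; toℕ<n)
open import Data.List using (List; []; _∷_; [_]; _++_; length; map; allFin; tabulate; reverse; reverseAcc; take)
open import Data.List.Membership.Propositional using (_∈_; _∉_; find; lose)
open import Data.List.Membership.Propositional.Properties using (∈-∃++; ∈-++⁺ˡ; ∈-tabulate⁻)
open import Data.List.Properties
  using (map-tabulate; unfold-reverse; length-reverse; ++-assoc; length-++; reverse-involutive;
         take++drop≡id; length-take; length-tabulate)
open import Data.List.Relation.Binary.Permutation.Propositional using (_↭_; ↭⇒↭ₛ; ↭-sym; ↭-refl)
open import Data.List.Relation.Binary.Permutation.Propositional.Properties
  using (↭-reverse; ++-comm; ∈-resp-↭; ↭-length)
import Data.List.Relation.Binary.Permutation.Setoid.Properties as PermutationSetoid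
open import Data.List.Relation.Binary.Subset.Propositional using (_⊆_)
open import Data.List.Relation.Binary.Subset.Propositional.Properties using (All-resp-⊇)
open import Data.List.Relation.Unary.All as All using (All; []; _∷_)
import Data.List.Relation.Unary.All.Properties as AllP
open import Data.List.Relation.Unary.AllPairs using ([]; _∷_)
open import Data.List.Relation.Unary.Any as Any using (Any; here; there)
open import Data.List.Relation.Unary.Linked as Linked using (Linked; []; [-]; _∷_)
open import Data.List.Relation.Unary.Unique.Propositional using (Unique)
import Data.List.Relation.Unary.Unique.Propositional.Properties as UniqueP
open import Data.Nat using (ℕ; zero; suc; _+_; _*_; _∸_; _≤_; _<_; _⊓_; _/_; _<ᵇ_; _≤ᵇ_; z≤n; s≤s; _≤?_)
open import Data.Nat.DivMod using (m/n*n≤m)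
open import Data.Nat.Induction using (<-wellFounded)
import Data.Nat.ListAction as ListAction
open import Data.Nat.Properties renaming (_≟_ to _≟ℕ_)
open import Algebra.Properties.CommutativeMonoid.Sum +-0-commutativeMonoid
  using (sum-syntax; sum-remove; sum-cong-≗; sum-replicate-zero; ∑-distrib-+; ∑-comm)
open import Data.Product as Product using (Σ; ∃; ∃₂; _×_; _,_; proj₁; proj₂)
open import Data.Sum as Sum using (_⊎_; inj₁; inj₂)
open import Data.Unit using (tt)
open import Function using (_∘_)
open import Function.Bundles using (Equivalence)
import Induction.WellFounded as WF
import Relation.Binary.Construct.On as On
open import Relation.Binary.PropositionalEquality
  using (_≡_; _≢_; refl; sym; trans; cong; cong₂; subst; subst₂; setoid; module ≡-Reasoning)
open import Relation.Nullary using (¬_; Dec; yes; no; does)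
open import Relation.Nullary.Decidable using (dec-true; dec-false; _×-dec_; ¬?; decidable-stable)

-- Finite sums and counting

∑-mono-≤ : ∀ {n} {f g : Fin n → ℕ} → (∀ i → f i ≤ g i) → ∑[ i < n ] f i ≤ ∑[ i < n ] g i
∑-mono-≤ {zero}  _   = z≤n
∑-mono-≤ {suc n} f≤g = +-mono-≤ (f≤g zero) (∑-mono-≤ (f≤g ∘ suc))

∑-≤1⇒≤n : ∀ {n} {f : Fin n → ℕ} → (∀ i → f i ≤ 1) → ∑[ i < n ] f i ≤ n
∑-≤1⇒≤n {zero}  _   = z≤n
∑-≤1⇒≤n {suc n} f≤1 = +-mono-≤ (f≤1 zero) (∑-≤1⇒≤n (f≤1 ∘ suc))

≤-∑ : ∀ {n} (f : Fin n → ℕ) (a : Fin n) → f a ≤ ∑[ i < n ] f i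
≤-∑ {suc n} f a = ≤-trans (m≤m+n (f a) _) (≤-reflexive (sym (sum-remove f)))

∑-suc-at : ∀ {n} {f g : Fin n → ℕ} (a : Fin n) → f a ≡ suc (g a) → (∀ i → i ≢ a → f i ≡ g i) →
           ∑[ i < n ] f i ≡ suc (∑[ i < n ] g i)
∑-suc-at {suc n} {f} {g} a fa≡ f≡g = begin
  ∑[ i < suc n ] f i                      ≡⟨ sum-remove f ⟩
  f a + ∑[ i < n ] f (punchIn a i)        ≡⟨ cong₂ _+_ fa≡ (sum-cong-≗ λ i → f≡g _ (punchInᵢ≢i a i)) ⟩
  suc (g a + ∑[ i < n ] g (punchIn a i))  ≡⟨ cong suc (sum-remove g) ⟨
  suc (∑[ i < suc n ] g i)                ∎
  where open ≡-Reasoning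

∑-<-at : ∀ {n} {f g : Fin n → ℕ} (a : Fin n) → f a < g a → (∀ i → f i ≤ g i) →
         ∑[ i < n ] f i < ∑[ i < n ] g i
∑-<-at {suc n} {f} {g} a fa<ga f≤g = begin-strict
  ∑[ i < suc n ] f i                ≡⟨ sum-remove f ⟩
  f a + ∑[ i < n ] f (punchIn a i)  <⟨ +-mono-<-≤ fa<ga (∑-mono-≤ (f≤g ∘ punchIn a)) ⟩
  g a + ∑[ i < n ] g (punchIn a i)  ≡⟨ sum-remove g ⟨
  ∑[ i < suc n ] g i                ∎
  where open ≤-Reasoning

listSum-allFin : ∀ {n} (f : Fin n → ℕ) → ListAction.sum (map f (allFin n)) ≡ ∑[ i < n ] f i
listSum-allFin f = trans (cong ListAction.sum (map-tabulate (λ i → i) f)) (listSum-tabulate f)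
  where
  listSum-tabulate : ∀ {m} (h : Fin m → ℕ) → ListAction.sum (tabulate h) ≡ ∑[ i < m ] h i
  listSum-tabulate {zero}  h = refl
  listSum-tabulate {suc m} h = cong (h zero +_) (listSum-tabulate (h ∘ suc))

m+m≤n+n⇒m≤n : ∀ {m n} → m + m ≤ n + n → m ≤ n
m+m≤n+n⇒m≤n h = ≮⇒≥ λ n<m → <⇒≱ (+-mono-< n<m n<m) h

m+m≡n+n⇒m≡n : ∀ {m n} → m + m ≡ n + n → m ≡ n
m+m≡n+n⇒m≡n h = ≤-antisym (m+m≤n+n⇒m≤n (≤-reflexive h)) (m+m≤n+n⇒m≤n (≤-reflexive (sym h)))

fromBool : Bool → ℕ
fromBool b = if b then 1 else 0

fromBool-mono : ∀ {a b} → (T a → T b) → fromBool a ≤ fromBool b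
fromBool-mono {false} _   = z≤n
fromBool-mono {true}  a⇒b = ≤-reflexive (cong fromBool (sym (Equivalence.to T-≡ (a⇒b tt))))

count : ∀ {n} → (Fin n → Bool) → ℕ
count {n} p = ∑[ i < n ] fromBool (p i)

count-≟ : ∀ {n} (x : Fin n) → count (λ i → does (i ≟ x)) ≡ 1
count-≟ {n} x = trans (∑-suc-at x at-x off-x) (cong suc (sum-replicate-zero n))
  where
  at-x : fromBool (does (x ≟ x)) ≡ 1
  at-x = cong fromBool (dec-true (x ≟ x) refl)
  off-x : ∀ i → i ≢ x → fromBool (does (i ≟ x)) ≡ 0
  off-x i i≢x = cong fromBool (dec-false (i ≟ x) i≢x)

multiplicity : ∀ {n} → List (Fin n) → Fin n → ℕ
multiplicity []       i = 0
multiplicity (x ∷ xs) i = fromBool (does (i ≟ x)) + multiplicity xs i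

∑-multiplicity : ∀ {n} (xs : List (Fin n)) → ∑[ i < n ] multiplicity xs i ≡ length xs
∑-multiplicity {n} []       = sum-replicate-zero n
∑-multiplicity     (x ∷ xs) = trans (∑-distrib-+ _ (multiplicity xs)) (cong₂ _+_ (count-≟ x) (∑-multiplicity xs))

∈⇒1≤multiplicity : ∀ {n} {i : Fin n} {xs} → i ∈ xs → 1 ≤ multiplicity xs i
∈⇒1≤multiplicity {i = i} (here refl)  =
  ≤-trans (≤-reflexive (cong fromBool (sym (dec-true (i ≟ i) refl)))) (m≤m+n _ _)
∈⇒1≤multiplicity         (there i∈xs) = ≤-trans (∈⇒1≤multiplicity i∈xs) (m≤n+m _ _)

count-≤-length : ∀ {n} {p : Fin n → Bool} {xs} → (∀ i → T (p i) → i ∈ xs) → count p ≤ length xs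
count-≤-length {n} {p} {xs} p⊆xs = begin
  count p                        ≤⟨ ∑-mono-≤ fromBool≤multiplicity ⟩
  ∑[ i < n ] multiplicity xs i   ≡⟨ ∑-multiplicity xs ⟩
  length xs                      ∎
  where
  open ≤-Reasoning
  fromBool≤multiplicity : ∀ i → fromBool (p i) ≤ multiplicity xs i
  fromBool≤multiplicity i with p i in pi≡
  ... | true  = ∈⇒1≤multiplicity (p⊆xs i (subst T (sym pi≡) tt))
  ... | false = z≤n

-- Degrees and edge removal

module _ {n} (G : Graph n) where
  open Graph G using (adj) renaming (sym to adj-sym; irrefl to adj-irrefl)
  open import Data.List.Membership.DecPropositional (_≟_ {n}) using (_∈?_)

  Adj-sym : ∀ {i j} → Adj G i j → Adj G j i
  Adj-sym {i} {j} = subst T (adj-sym i j)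

  Adj⇒≢ : ∀ {i j} → Adj G i j → i ≢ j
  Adj⇒≢ {i} i~i refl = subst T (adj-irrefl i) i~i

  adj? : ∀ i j → Dec (Adj G i j)
  adj? i j = T? (adj i j)

  deg : Fin n → ℕ
  deg x = count (adj x)

  Adj⇒1≤deg : ∀ {x w} → Adj G x w → 1 ≤ deg x
  Adj⇒1≤deg {x} {w} x~w = subst (λ b → fromBool b ≤ deg x) (Equivalence.to T-≡ x~w) (≤-∑ _ w)

  ∃neighbour∉ : ∀ {x} xs → length xs < deg x → ∃ λ w → Adj G x w × w ∉ xs
  ∃neighbour∉ {x} xs |xs|<deg with any? (λ w → adj? x w ×-dec ¬? (w ∈? xs))
  ... | yes found = found
  ... | no  none  = ⊥-elim (<⇒≱ |xs|<deg (count-≤-length neighbour∈xs))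
    where
    neighbour∈xs : ∀ w → Adj G x w → w ∈ xs
    neighbour∈xs w x~w = decidable-stable (w ∈? xs) (λ w∉xs → none (w , x~w , w∉xs))

  upperAdj : Fin n → Fin n → Bool
  upperAdj i j = adj i j ∧ (toℕ i <ᵇ toℕ j)

  edgeCount≡∑ : edgeCount G ≡ ∑[ i < n ] ∑[ j < n ] fromBool (upperAdj i j)
  edgeCount≡∑ = trans (listSum-allFin row) (sum-cong-≗ λ i → listSum-allFin (λ j → fromBool (upperAdj i j)))
    where
    row : Fin n → ℕ
    row i = ListAction.sum (map (λ j → fromBool (upperAdj i j)) (allFin n))

  fromBool-adj-split : ∀ i j → fromBool (adj i j) ≡ fromBool (upperAdj i j) + fromBool (upperAdj j i)
  fromBool-adj-split i j with toℕ i <ᵇ toℕ j in i<ᵇj | toℕ j <ᵇ toℕ i in j<ᵇi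
  ... | true  | true  = ⊥-elim (<-asym (<ᵇ⇒< (toℕ i) (toℕ j) (subst T (sym i<ᵇj) tt))
                                     (<ᵇ⇒< (toℕ j) (toℕ i) (subst T (sym j<ᵇi) tt)))
  ... | true  | false rewrite ∧-identityʳ (adj i j) | ∧-zeroʳ (adj j i) = sym (+-identityʳ _)
  ... | false | true  rewrite ∧-zeroʳ (adj i j) | ∧-identityʳ (adj j i) = cong fromBool (adj-sym i j)
  ... | false | false with toℕ-injective {i = i} {j} (≤-antisym (≮⇒≥ (λ j<i → subst T j<ᵇi (<⇒<ᵇ j<i)))
                                                             (≮⇒≥ (λ i<j → subst T i<ᵇj (<⇒<ᵇ i<j))))
  ...   | refl rewrite adj-irrefl i = refl

  handshake : ∑[ i < n ] deg i ≡ edgeCount G + edgeCount G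
  handshake = begin
    ∑[ i < n ] ∑[ j < n ] fromBool (adj i j)
      ≡⟨ sum-cong-≗ (λ i → trans (sum-cong-≗ (fromBool-adj-split i)) (∑-distrib-+ (up i) (down i))) ⟩
    ∑[ i < n ] (∑[ j < n ] up i j + ∑[ j < n ] down i j)
      ≡⟨ ∑-distrib-+ (λ i → ∑[ j < n ] up i j) (λ i → ∑[ j < n ] down i j) ⟩
    ∑[ i < n ] ∑[ j < n ] up i j + ∑[ i < n ] ∑[ j < n ] up j i
      ≡⟨ cong (∑[ i < n ] ∑[ j < n ] up i j +_) (∑-comm down) ⟩
    ∑[ i < n ] ∑[ j < n ] up i j + ∑[ i < n ] ∑[ j < n ] up i j
      ≡⟨ cong₂ _+_ edgeCount≡∑ edgeCount≡∑ ⟨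
    edgeCount G + edgeCount G ∎
    where
    open ≡-Reasoning
    up down : Fin n → Fin n → ℕ
    up i j = fromBool (upperAdj i j)
    down i j = fromBool (upperAdj j i)

sameEdge : ∀ {n} → Fin n → Fin n → Fin n → Fin n → Bool
sameEdge a b i j = (does (i ≟ a) ∧ does (j ≟ b)) ∨ (does (i ≟ b) ∧ does (j ≟ a))

sameEdge-sym : ∀ {n} (a b i j : Fin n) → sameEdge a b i j ≡ sameEdge a b j i
sameEdge-sym a b i j rewrite ∧-comm (does (i ≟ a)) (does (j ≟ b)) | ∧-comm (does (i ≟ b)) (does (j ≟ a)) =
  ∨-comm (does (j ≟ b) ∧ does (i ≟ a)) (does (j ≟ a) ∧ does (i ≟ b))

sameEdge-comm : ∀ {n} (a b i j : Fin n) → sameEdge a b i j ≡ sameEdge b a i j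
sameEdge-comm a b i j = ∨-comm (does (i ≟ a) ∧ does (j ≟ b)) (does (i ≟ b) ∧ does (j ≟ a))

sameEdge-refl : ∀ {n} (a b : Fin n) → sameEdge a b a b ≡ true
sameEdge-refl a b rewrite dec-true (a ≟ a) refl | dec-true (b ≟ b) refl = refl

sameEdge-false : ∀ {n} {a b i j : Fin n} → (i ≢ a ⊎ j ≢ b) → (i ≢ b ⊎ j ≢ a) → sameEdge a b i j ≡ false
sameEdge-false {i = i} {j} ab ba = cong₂ _∨_ (both-false ab) (both-false ba)
  where
  both-false : ∀ {x y} → (i ≢ x ⊎ j ≢ y) → does (i ≟ x) ∧ does (j ≟ y) ≡ false
  both-false {x}     (inj₁ i≢x) rewrite dec-false (i ≟ x) i≢x = refl
  both-false {x} {y} (inj₂ j≢y) rewrite dec-false (j ≟ y) j≢y = ∧-zeroʳ (does (i ≟ x))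

removeEdge : ∀ {n} → Graph n → Fin n → Fin n → Graph n
removeEdge G a b = record
  { adj    = λ i j → adj i j ∧ not (sameEdge a b i j)
  ; sym    = λ i j → cong₂ (λ x y → x ∧ not y) (adj-sym i j) (sameEdge-sym a b i j)
  ; irrefl = λ i → cong (_∧ not (sameEdge a b i i)) (adj-irrefl i)
  }
  where open Graph G using (adj) renaming (sym to adj-sym; irrefl to adj-irrefl)

record _⊑_ {n} (H G : Graph n) : Set where
  constructor subgraph
  field adj-⊑ : ∀ {i j} → Adj H i j → Adj G i j

module _ {n} (G : Graph n) (a b : Fin n) where
  open Graph G using (adj)
  private
    G′ : Graph n
    G′ = removeEdge G a b

  removeEdge-⊑ : G′ ⊑ G
  removeEdge-⊑ = subgraph λ {i} {j} → proj₁ ∘ Equivalence.to (T-∧ {adj i j})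

  removeEdge-¬Adj : ¬ Adj G′ a b
  removeEdge-¬Adj a~b rewrite sameEdge-refl a b | ∧-zeroʳ (adj a b) = a~b

  adj-removeEdge : ∀ {i j} → sameEdge a b i j ≡ false → Graph.adj G′ i j ≡ adj i j
  adj-removeEdge {i} {j} ≢ab rewrite ≢ab = ∧-identityʳ (adj i j)

  deg-removeEdge-other : ∀ {i} → i ≢ a → i ≢ b → deg G′ i ≡ deg G i
  deg-removeEdge-other {i} i≢a i≢b =
    sum-cong-≗ λ j → cong fromBool (adj-removeEdge (sameEdge-false {j = j} (inj₁ i≢a) (inj₁ i≢b)))

  deg-removeEdgeˡ : Adj G a b → deg G a ≡ suc (deg G′ a)
  deg-removeEdgeˡ a~b = ∑-suc-at b at-b off-b
    where
    at-b : fromBool (adj a b) ≡ suc (fromBool (Graph.adj G′ a b))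
    at-b rewrite sameEdge-refl a b | ∧-zeroʳ (adj a b) | Equivalence.to T-≡ a~b = refl
    off-b : ∀ j → j ≢ b → fromBool (adj a j) ≡ fromBool (Graph.adj G′ a j)
    off-b j j≢b = cong fromBool (sym (adj-removeEdge (sameEdge-false (inj₂ j≢b) (inj₁ (Adj⇒≢ G a~b)))))

module _ {n} (G : Graph n) {a b : Fin n} (a~b : Adj G a b) where
  private
    G′ : Graph n
    G′ = removeEdge G a b

  deg-removeEdgeʳ : deg G b ≡ suc (deg G′ b)
  deg-removeEdgeʳ = trans (deg-removeEdgeˡ G b a (Adj-sym G a~b))
    (cong suc (sum-cong-≗ λ j → cong (λ e → fromBool (Graph.adj G b j ∧ not e)) (sameEdge-comm b a b j)))

  ∑deg-removeEdge : ∑[ i < n ] deg G i ≡ suc (suc (∑[ i < n ] deg G′ i))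
  ∑deg-removeEdge = begin
    ∑[ i < n ] deg G i                            ≡⟨ ∑-suc-at a at-a off-a ⟩
    suc (∑[ i < n ] (deg G′ i + δb i))            ≡⟨ cong suc (∑-distrib-+ (deg G′) δb) ⟩
    suc (∑[ i < n ] deg G′ i + count (λ i → does (i ≟ b)))
                                                  ≡⟨ cong (λ c → suc (∑[ i < n ] deg G′ i + c)) (count-≟ b) ⟩
    suc (∑[ i < n ] deg G′ i + 1)                 ≡⟨ cong suc (+-comm _ 1) ⟩
    suc (suc (∑[ i < n ] deg G′ i))               ∎
    where
    open ≡-Reasoning
    δb : Fin n → ℕ
    δb i = fromBool (does (i ≟ b))
    at-a : deg G a ≡ suc (deg G′ a + δb a)
    at-a = trans (deg-removeEdgeˡ G a b a~b)
                 (cong suc (sym (trans (cong (λ c → deg G′ a + fromBool c) (dec-false (a ≟ b) (Adj⇒≢ G a~b)))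
                                       (+-identityʳ _))))
    off-a : ∀ i → i ≢ a → deg G i ≡ deg G′ i + δb i
    off-a i i≢a = by-cases (i ≟ b)
      where
      by-cases : Dec (i ≡ b) → deg G i ≡ deg G′ i + δb i
      by-cases (yes refl) = trans deg-removeEdgeʳ
        (trans (+-comm 1 _) (cong (λ c → deg G′ b + fromBool c) (sym (dec-true (b ≟ b) refl))))
      by-cases (no i≢b)   = trans (sym (deg-removeEdge-other G a b i≢a i≢b))
        (trans (sym (+-identityʳ _)) (cong (λ c → deg G′ i + fromBool c) (sym (dec-false (i ≟ b) i≢b))))

  edgeCount-removeEdge : edgeCount G ≡ suc (edgeCount G′)
  edgeCount-removeEdge = m+m≡n+n⇒m≡n (begin
    edgeCount G + edgeCount G                ≡⟨ handshake G ⟨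
    ∑[ i < n ] deg G i                       ≡⟨ ∑deg-removeEdge ⟩
    suc (suc (∑[ i < n ] deg G′ i))          ≡⟨ cong (2 +_) (handshake G′) ⟩
    suc (suc (edgeCount G′ + edgeCount G′))  ≡⟨ cong suc (+-suc _ _) ⟨
    suc (edgeCount G′) + suc (edgeCount G′)  ∎)
    where open ≡-Reasoning

edgeInduction : ∀ {n ℓ} (P : Graph n → Set ℓ) →
                (∀ G → (∀ {H} → edgeCount H < edgeCount G → P H) → P G) → ∀ G → P G
edgeInduction {ℓ = ℓ} = WF.All.wfRec (On.wellFounded edgeCount <-wellFounded) ℓ

module _ {n} {H G : Graph n} (H⊑G : H ⊑ G) where
  open _⊑_ H⊑G

  deg-mono : ∀ x → deg H x ≤ deg G x
  deg-mono x = ∑-mono-≤ λ j → fromBool-mono (adj-⊑ {x} {j})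

  Linked-⊑ : ∀ {xs} → Linked (Adj H) xs → Linked (Adj G) xs
  Linked-⊑ = Linked.map adj-⊑

  Within-⊑ : ∀ {r v u} → Within H r v u → Within G r v u
  Within-⊑ here         = here
  Within-⊑ (step w u~x) = step (Within-⊑ w) (adj-⊑ u~x)

  IsCycle-⊑ : ∀ c → IsCycle H c → IsCycle G c
  IsCycle-⊑ (x ∷ xs) (3≤ , unique , linked , last~x) = 3≤ , unique , Linked-⊑ linked , adj-⊑ last~x

  BicycleFree-⊒ : ∀ {r} → BicycleFree G r → BicycleFree H r
  BicycleFree-⊒ bicycleFree v c d c-cycle c-ball d-cycle d-ball =
    bicycleFree v c d (IsCycle-⊑ c c-cycle) (All.map Within-⊑ c-ball) (IsCycle-⊑ d d-cycle) (All.map Within-⊑ d-ball)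

  IsBipartition-⊒ : ∀ {side} → IsBipartition G side → IsBipartition H side
  IsBipartition-⊒ bipartite i j i~j = bipartite i j (adj-⊑ i~j)

  IsLLPath-⊑ : ∀ {side ℓ p} → IsLLPath H side ℓ p → IsLLPath G side ℓ p
  IsLLPath-⊑ (unique , linked , short , ends) = unique , Linked-⊑ linked , short , ends

nonIsolated : ∀ {n} → Graph n → ℕ
nonIsolated {n} G = ∑[ i < n ] (1 ⊓ deg G i)

nonIsolated≤n : ∀ {n} (G : Graph n) → nonIsolated G ≤ n
nonIsolated≤n G = ∑-≤1⇒≤n (λ i → m⊓n≤m 1 (deg G i))

nonIsolated-removeLeaf : ∀ {n} (G : Graph n) {u w} → Adj G u w → deg G u ≡ 1 →
                         nonIsolated (removeEdge G u w) < nonIsolated G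
nonIsolated-removeLeaf G {u} {w} u~w deg≡1 =
  ∑-<-at u at-u (λ i → ⊓-monoʳ-≤ 1 (deg-mono (removeEdge-⊑ G u w) i))
  where
  at-u : 1 ⊓ deg (removeEdge G u w) u < 1 ⊓ deg G u
  at-u = subst₂ (λ d′ d → 1 ⊓ d′ < 1 ⊓ d) (suc-injective (trans (sym deg≡1) (deg-removeEdgeˡ G u w u~w)))
                (sym deg≡1) ≤-refl

maxDeg≤2⇒edgeCount≤nonIsolated : ∀ {n} (G : Graph n) → (∀ i → deg G i ≤ 2) → edgeCount G ≤ nonIsolated G
maxDeg≤2⇒edgeCount≤nonIsolated {n} G deg≤2 = m+m≤n+n⇒m≤n (begin
  edgeCount G + edgeCount G                 ≡⟨ handshake G ⟨
  ∑[ i < n ] deg G i                        ≤⟨ ∑-mono-≤ (λ i → ≤2⇒≤⊓+⊓ (deg≤2 i)) ⟩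
  ∑[ i < n ] (1 ⊓ deg G i + 1 ⊓ deg G i)    ≡⟨ ∑-distrib-+ (λ i → 1 ⊓ deg G i) (λ i → 1 ⊓ deg G i) ⟩
  nonIsolated G + nonIsolated G             ∎)
  where
  open ≤-Reasoning
  ≤2⇒≤⊓+⊓ : ∀ {d} → d ≤ 2 → d ≤ 1 ⊓ d + 1 ⊓ d
  ≤2⇒≤⊓+⊓ {0}                 _ = z≤n
  ≤2⇒≤⊓+⊓ {1}                 _ = s≤s z≤n
  ≤2⇒≤⊓+⊓ {2}                 _ = ≤-refl
  ≤2⇒≤⊓+⊓ {suc (suc (suc _))} (s≤s (s≤s ()))

-- Paths and cycles

module _ {A : Set} where

  Unique-resp-↭ : ∀ {xs ys : List A} → xs ↭ ys → Unique xs → Unique ys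
  Unique-resp-↭ xs↭ys = PermutationSetoid.Unique-resp-↭ (setoid A) (↭⇒↭ₛ xs↭ys)

  Unique-++⁻ˡ : ∀ xs {ys : List A} → Unique (xs ++ ys) → Unique xs
  Unique-++⁻ˡ []       _              = []
  Unique-++⁻ˡ (x ∷ xs) (x∉xs++ys ∷ u) = AllP.++⁻ˡ xs x∉xs++ys ∷ Unique-++⁻ˡ xs u

  Unique-++⇒∉ : ∀ xs {ys : List A} {z} → Unique (xs ++ ys) → z ∈ xs → z ∉ ys
  Unique-++⇒∉ (x ∷ xs) (x∉ ∷ _) (here refl)  z∈ys = All.lookup (AllP.++⁻ʳ xs x∉) z∈ys refl
  Unique-++⇒∉ (x ∷ xs) (_ ∷ u)  (there z∈xs) = Unique-++⇒∉ xs u z∈xs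

  module _ {R : A → A → Set} where

    Linked-++⁻ : ∀ xs {ys} → Linked R (xs ++ ys) → Linked R xs × Linked R ys
    Linked-++⁻ []           linked          = [] , linked
    Linked-++⁻ (x ∷ [])     {[]}     linked = [-] , []
    Linked-++⁻ (x ∷ [])     {y ∷ ys} (_ ∷ linked) = [-] , linked
    Linked-++⁻ (x ∷ y ∷ xs) (r ∷ linked)    = Product.map₁ (r ∷_) (Linked-++⁻ (y ∷ xs) linked)

    Linked-take : ∀ m {xs} → Linked R xs → Linked R (take m xs)
    Linked-take m {xs} linked = proj₁ (Linked-++⁻ (take m xs) (subst (Linked R) (sym (take++drop≡id m xs)) linked))

    Linked-reverse : (∀ {x y} → R x y → R y x) → ∀ {xs} → Linked R xs → Linked R (reverse xs)
    Linked-reverse R-sym []              = []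
    Linked-reverse R-sym {x ∷ xs} linked = onto [] [-] linked
      where
      onto : ∀ {y ys} acc → Linked R (y ∷ acc) → Linked R (y ∷ ys) → Linked R (reverseAcc (y ∷ acc) ys)
      onto acc done [-]        = done
      onto acc done (r ∷ rest) = onto (_ ∷ acc) (R-sym r ∷ done) rest

module _ {n} (G : Graph n) where

  IsPath : List (Fin n) → Set
  IsPath p = Unique p × Linked (Adj G) p

  lastOf-∈ : ∀ x xs → lastOf G x xs ∈ x ∷ xs
  lastOf-∈ x []       = here refl
  lastOf-∈ x (y ∷ ys) = there (lastOf-∈ y ys)

  lastOf-++ : ∀ x xs y ys → lastOf G x (xs ++ y ∷ ys) ≡ lastOf G y ys
  lastOf-++ x []       y ys = refl
  lastOf-++ x (z ∷ zs) y ys = lastOf-++ z zs y ys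

  Linked-join : ∀ {x xs y ys} → Linked (Adj G) (x ∷ xs) → Adj G (lastOf G x xs) y →
                Linked (Adj G) (y ∷ ys) → Linked (Adj G) ((x ∷ xs) ++ y ∷ ys)
  Linked-join [-]          last~y linked′ = last~y ∷ linked′
  Linked-join (r ∷ linked) last~y linked′ = r ∷ Linked-join linked last~y linked′

  reverse-∷ : ∀ x xs → ∃₂ λ c cs → reverse (x ∷ xs) ≡ c ∷ cs × c ≡ lastOf G x xs × lastOf G c cs ≡ x
  reverse-∷ x []       = x , [] , refl , refl , refl
  reverse-∷ x (y ∷ ys) with reverse-∷ y ys
  ... | c , cs , rev≡ , c≡ , _ =
    c , cs ++ [ x ] , trans (unfold-reverse x (y ∷ ys)) (cong (_++ [ x ]) rev≡) , c≡ , lastOf-++ c cs x []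

  record Reversal (a b : Fin n) (ps : List (Fin n)) : Set where
    constructor reversal
    field
      {c d}      : Fin n
      {rs}       : List (Fin n)
      path       : IsPath (c ∷ d ∷ rs)
      ↭-original : (c ∷ d ∷ rs) ↭ (a ∷ b ∷ ps)
      head≡last  : c ≡ lastOf G a (b ∷ ps)
      last≡head  : lastOf G c (d ∷ rs) ≡ a

  reversal-of : ∀ {a b ps} → IsPath (a ∷ b ∷ ps) → Reversal a b ps
  reversal-of {a} {b} {ps} (unique , linked) with reverse-∷ a (b ∷ ps) | length-reverse (a ∷ b ∷ ps)
  ... | c , d ∷ rs , rev≡ , c≡ , last≡ | _ =
    reversal (subst IsPath rev≡ ( Unique-resp-↭ (↭-sym (↭-reverse (a ∷ b ∷ ps))) unique
                                , Linked-reverse (Adj-sym G) linked))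
             (subst (_↭ (a ∷ b ∷ ps)) rev≡ (↭-reverse (a ∷ b ∷ ps))) c≡ last≡
  ... | c , [] , rev≡ , _ , _ | length≡ with () ← trans (sym (cong length rev≡)) length≡

  reversal-sym : ∀ {a b ps} → IsPath (a ∷ b ∷ ps) → (r : Reversal a b ps) →
                 Reversal (Reversal.c r) (Reversal.d r) (Reversal.rs r)
  reversal-sym path (reversal _ ↭-original head≡last last≡head) =
    reversal path (↭-sym ↭-original) (sym last≡head) (sym head≡last)

  rotate : ∀ {a xs x} → Linked (Adj G) (a ∷ xs) → Adj G (lastOf G a xs) a → x ∈ a ∷ xs →
           ∃ λ rs → (x ∷ rs) ↭ (a ∷ xs) × Linked (Adj G) (x ∷ rs)
  rotate linked last~a x∈ with ∈-∃++ x∈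
  ... | []    , B , refl = B , ↭-refl , linked
  ... | a ∷ A , B , refl with Linked-++⁻ (a ∷ A) linked
  ...   | linkedA , linkedB =
    B ++ a ∷ A , ++-comm (_ ∷ B) (a ∷ A) ,
    Linked-join linkedB (subst (λ l → Adj G l a) (lastOf-++ a A _ B) last~a) linkedA

  chordCycle : ∀ {a b ps z} → IsPath (a ∷ b ∷ ps) → z ∈ ps → Adj G a z →
               ∃ λ C → IsCycle G (a ∷ C) × (a ∷ C) ⊆ (a ∷ b ∷ ps)
                     × (lastOf G a (b ∷ ps) ∈ a ∷ C → lastOf G a (b ∷ ps) ≡ z)
  chordCycle {a} {b} {z = z} (unique , linked) z∈ps a~z with ∈-∃++ z∈ps
  ... | A , B , refl = b ∷ A ++ [ z ] , cycle , prefix⊆path , last∈prefix⇒≡z B unique′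
    where
    prefix : List (Fin n)
    prefix = a ∷ b ∷ A ++ [ z ]
    split : a ∷ b ∷ A ++ z ∷ B ≡ prefix ++ B
    split = cong (λ xs → a ∷ b ∷ xs) (sym (++-assoc A [ z ] B))
    prefix⊆path : prefix ⊆ a ∷ b ∷ A ++ z ∷ B
    prefix⊆path {x} x∈ = subst (x ∈_) (sym split) (∈-++⁺ˡ x∈)
    unique′ : Unique (prefix ++ B)
    unique′ = subst Unique split unique
    cycle : IsCycle G prefix
    cycle = s≤s (s≤s (subst (1 ≤_) (sym (length-++ A)) (m≤n+m 1 (length A))))
          , Unique-++⁻ˡ prefix unique′
          , proj₁ (Linked-++⁻ prefix (subst (Linked (Adj G)) split linked))
          , subst (λ x → Adj G x a) (sym (lastOf-++ a (b ∷ A) z [])) (Adj-sym G a~z)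
    last∈prefix⇒≡z : ∀ B → Unique (prefix ++ B) →
                     lastOf G a (b ∷ A ++ z ∷ B) ∈ prefix → lastOf G a (b ∷ A ++ z ∷ B) ≡ z
    last∈prefix⇒≡z []       _ _     = lastOf-++ a (b ∷ A) z []
    last∈prefix⇒≡z (y ∷ B′) u last∈ = ⊥-elim (Unique-++⇒∉ prefix u last∈
      (subst (_∈ y ∷ B′) (sym (lastOf-++ a (b ∷ A) z (y ∷ B′))) (lastOf-∈ y B′)))

  Within-∷ : ∀ {x y r u} → Adj G x y → Within G r y u → Within G (suc r) x u
  Within-∷ x~y here         = step here x~y
  Within-∷ x~y (step w u~v) = step (Within-∷ x~y w) u~v

  Within-mono : ∀ {r s v u} → r ≤ s → Within G r v u → Within G s v u
  Within-mono _         here         = here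
  Within-mono (s≤s r≤s) (step w u~v) = step (Within-mono r≤s w) u~v

  path⊆ball : ∀ {x xs} → Linked (Adj G) (x ∷ xs) → All (Within G (length xs) x) (x ∷ xs)
  path⊆ball [-]            = here ∷ []
  path⊆ball (x~y ∷ linked) = here ∷ All.map (Within-∷ x~y) (path⊆ball linked)

  pathEdges-∈ : ∀ {i j} xs → (i , j) ∈ pathEdges G xs → i ∈ xs × j ∈ xs
  pathEdges-∈ (x ∷ y ∷ ys) (here refl) = here refl , there (here refl)
  pathEdges-∈ (x ∷ y ∷ ys) (there e)   = Product.map there there (pathEdges-∈ (y ∷ ys) e)

  cycleEdges-∈ : ∀ {i j} c → (i , j) ∈ cycleEdges G c → i ∈ c × j ∈ c
  cycleEdges-∈ (x ∷ xs) (here refl) = lastOf-∈ x xs , here refl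
  cycleEdges-∈ (x ∷ xs) (there e)   = pathEdges-∈ (x ∷ xs) e

  ∈⇒pathEdge⊎≡lastOf : ∀ {i} x xs → i ∈ x ∷ xs →
                       (∃ λ j → (i , j) ∈ pathEdges G (x ∷ xs)) ⊎ i ≡ lastOf G x xs
  ∈⇒pathEdge⊎≡lastOf x []       (here refl) = inj₂ refl
  ∈⇒pathEdge⊎≡lastOf x (y ∷ ys) (here refl) = inj₁ (y , here refl)
  ∈⇒pathEdge⊎≡lastOf x (y ∷ ys) (there i∈)  =
    Sum.map₁ (Product.map₂ there) (∈⇒pathEdge⊎≡lastOf y ys i∈)

  ∈⇒cycleEdge : ∀ {i} c → i ∈ c → ∃ λ j → (i , j) ∈ cycleEdges G c
  ∈⇒cycleEdge (x ∷ xs) i∈c with ∈⇒pathEdge⊎≡lastOf x xs i∈c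
  ... | inj₁ (j , e) = j , there e
  ... | inj₂ refl    = x , here refl

  SameCycle⇒⊇ : ∀ {c d} → SameCycle G c d → d ⊆ c
  SameCycle⇒⊇ {c} {d} same {i} i∈d with ∈⇒cycleEdge d i∈d
  ... | j , e with Equivalence.from (same i j) (inj₁ e)
  ...   | inj₁ e′ = proj₁ (cycleEdges-∈ c e′)
  ...   | inj₂ e′ = proj₂ (cycleEdges-∈ c e′)

-- C₁ stops at z ≢ c, so it misses c, while C₂ starts at c: two different cycles in the g-ball around a.
twoChords⇒⊥ : ∀ {n} (G : Graph n) {g} → BicycleFree G g →
              ∀ {a b ps} → IsPath G (a ∷ b ∷ ps) → length (b ∷ ps) ≤ g → (r : Reversal G a b ps) →
              ∀ {z y} → z ∈ ps → Adj G a z → z ≢ Reversal.c r →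
              y ∈ Reversal.rs r → Adj G (Reversal.c r) y → ⊥
twoChords⇒⊥ G {g} bicycleFree {a} {b} {ps} path short (reversal {c} path′ ↭P c≡last _) z∈ps a~z z≢c y∈rs c~y
  with chordCycle G path z∈ps a~z | chordCycle G path′ y∈rs c~y
... | C₁ , cycle₁ , C₁⊆P , last∈C₁⇒≡z | C₂ , cycle₂ , C₂⊆R , _ = z≢c (sym c≡z)
  where
  ball : All (Within G g a) (a ∷ b ∷ ps)
  ball = All.map (Within-mono G short) (path⊆ball G (proj₂ path))
  same : SameCycle G (a ∷ C₁) (c ∷ C₂)
  same = bicycleFree a (a ∷ C₁) (c ∷ C₂) cycle₁ (All-resp-⊇ C₁⊆P ball)
                                         cycle₂ (All-resp-⊇ (∈-resp-↭ ↭P ∘ C₂⊆R) ball)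
  c≡z : c ≡ _
  c≡z = trans c≡last (last∈C₁⇒≡z (subst (_∈ a ∷ C₁) c≡last (SameCycle⇒⊇ G same (here refl))))

-- Long paths in bicycle-free graphs

LongPath : ∀ {n} → Graph n → ℕ → Set
LongPath G ℓ = ∃ λ p → IsPath G p × ℓ < length p

LongPath-mono : ∀ {n} {G : Graph n} {ℓ ℓ′} → ℓ ≤ ℓ′ → LongPath G ℓ′ → LongPath G ℓ
LongPath-mono ℓ≤ℓ′ (p , path , long) = p , path , <-≤-trans (s≤s ℓ≤ℓ′) long

LongPath-⊑ : ∀ {n} {H G : Graph n} {ℓ} → H ⊑ G → LongPath H ℓ → LongPath G ℓ
LongPath-⊑ H⊑G (p , (unique , linked) , long) = p , (unique , Linked-⊑ H⊑G linked) , long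

module _ {n} (G : Graph n) where
  open import Data.List.Membership.DecPropositional (_≟_ {n}) using (_∈?_)

  Closed : Fin n → List (Fin n) → Set
  Closed x P = ∀ {w} → Adj G x w → w ∈ P

  Escape : Fin n → List (Fin n) → Set
  Escape x P = ∃ λ w → Adj G x w × w ∉ P

  escape? : ∀ x P → Dec (Escape x P)
  escape? x P = any? (λ w → adj? G x w ×-dec ¬? (w ∈? P))

  ¬Escape⇒Closed : ∀ {x P} → ¬ Escape x P → Closed x P
  ¬Escape⇒Closed {P = P} ¬escape {w} x~w = decidable-stable (w ∈? P) (λ w∉P → ¬escape (w , x~w , w∉P))

  Closed-resp-↭ : ∀ {x P Q} → P ↭ Q → Closed x P → Closed x Q
  Closed-resp-↭ P↭Q closed = ∈-resp-↭ P↭Q ∘ closed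

  chordFrom : ∀ {x y zs avoid} → Closed x (x ∷ y ∷ zs) → Escape x (y ∷ avoid) →
              ∃ λ w → w ∈ zs × Adj G x w × w ∉ avoid
  chordFrom closed (w , x~w , w∉) with closed x~w
  ... | here w≡x           = ⊥-elim (Adj⇒≢ G x~w (sym w≡x))
  ... | there (here w≡y)   = ⊥-elim (w∉ (here w≡y))
  ... | there (there w∈zs) = w , w∈zs , x~w , w∉ ∘ there

  record Stuck (a : Fin n) (xs : List (Fin n)) : Set where
    field
      head-closed  : Closed a (a ∷ xs)
      last-closed  : Closed (lastOf G a xs) (a ∷ xs)
      cycle-closed : Adj G (lastOf G a xs) a → ∀ {x} → x ∈ a ∷ xs → Closed x (a ∷ xs)

  record Extension (a b : Fin n) (ps : List (Fin n)) : Set where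
    constructor extension
    field
      {a′ b′}    : Fin n
      {ps′}      : List (Fin n)
      path       : IsPath G (a′ ∷ b′ ∷ ps′)
      ⊇-original : (a ∷ b ∷ ps) ⊆ (a′ ∷ b′ ∷ ps′)
      longer     : length ps′ ≡ suc (length ps)

  module _ {a b ps} (path : IsPath G (a ∷ b ∷ ps)) where
    private
      P : List (Fin n)
      P = a ∷ b ∷ ps
      unique : Unique P
      unique = proj₁ path
      linked : Linked (Adj G) P
      linked = proj₂ path

    extend-last : Escape (lastOf G a (b ∷ ps)) P → Extension a b ps
    extend-last (w , last~w , w∉P) =
      extension (UniqueP.++⁺ unique ([] ∷ []) (λ { (w∈P , here refl) → w∉P w∈P }) , Linked-join G linked last~w [-])
                ∈-++⁺ˡ (trans (length-++ ps) (+-comm _ 1))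

    extend-head : Escape a P → Extension a b ps
    extend-head (w , a~w , w∉P) = extension (AllP.¬Any⇒All¬ P w∉P ∷ unique , Adj-sym G a~w ∷ linked) there refl

    extend-cycle : Adj G (lastOf G a (b ∷ ps)) a → Any (λ x → Escape x P) P → Extension a b ps
    extend-cycle last~a escapes with find escapes
    ... | x , x∈P , w , x~w , w∉P with rotate G linked last~a x∈P
    ...   | rs , x∷rs↭P , linked′ =
      extension (AllP.¬Any⇒All¬ (x ∷ rs) (w∉P ∘ ∈-resp-↭ x∷rs↭P) ∷ Unique-resp-↭ (↭-sym x∷rs↭P) unique
                , Adj-sym G x~w ∷ linked′)
                (there ∘ ∈-resp-↭ (↭-sym x∷rs↭P)) (suc-injective (↭-length x∷rs↭P))

    extend : Extension a b ps ⊎ Stuck a (b ∷ ps)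
    extend with escape? (lastOf G a (b ∷ ps)) P | escape? a P
    ... | yes escape | _          = inj₁ (extend-last escape)
    ... | no  _      | yes escape = inj₁ (extend-head escape)
    ... | no  ¬last  | no  ¬head with adj? G (lastOf G a (b ∷ ps)) a
    ...   | no ¬last~a = inj₂ record { head-closed  = ¬Escape⇒Closed ¬head
                                     ; last-closed  = ¬Escape⇒Closed ¬last
                                     ; cycle-closed = ⊥-elim ∘ ¬last~a }
    ...   | yes last~a with Any.any? (λ x → escape? x P) P
    ...     | yes escapes  = inj₁ (extend-cycle last~a escapes)
    ...     | no  ¬escapes = inj₂ record
      { head-closed  = ¬Escape⇒Closed ¬head
      ; last-closed  = ¬Escape⇒Closed ¬last
      ; cycle-closed = λ _ x∈P → ¬Escape⇒Closed (λ escape → ¬escapes (lose x∈P escape)) }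

module _ {n} (G : Graph n) {g} (bicycleFree : BicycleFree G g)
         (noLeaf : ∀ {x w} → Adj G x w → 2 ≤ deg G x) where

  headChord⇒⊥ : ∀ {a b ps} → IsPath G (a ∷ b ∷ ps) → length (b ∷ ps) ≤ g → (r : Reversal G a b ps) →
                Closed G a (a ∷ b ∷ ps) → Closed G (Reversal.c r) (a ∷ b ∷ ps) →
                Escape G a (b ∷ Reversal.c r ∷ []) → ⊥
  headChord⇒⊥ path short r@(reversal {c} {d} path′ ↭P _ _) a-closed c-closed escape
    with chordFrom G a-closed escape
       | chordFrom G (Closed-resp-↭ G (↭-sym ↭P) c-closed)
                     (∃neighbour∉ G (d ∷ []) (noLeaf (Linked.head (proj₂ path′))))
  ... | z , z∈ps , a~z , z∉[c] | y , y∈rs , c~y , _ =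
    twoChords⇒⊥ G bicycleFree path short r z∈ps a~z (z∉[c] ∘ here) y∈rs c~y

  module _ {v} (deg-v : 3 ≤ deg G v) where

    closedCycle⇒⊥ : ∀ {a b ps} → IsPath G (a ∷ b ∷ ps) → length (b ∷ ps) ≤ g → v ∈ a ∷ b ∷ ps →
                    Adj G (lastOf G a (b ∷ ps)) a → (∀ {x} → x ∈ a ∷ b ∷ ps → Closed G x (a ∷ b ∷ ps)) → ⊥
    closedCycle⇒⊥ (unique , linked) short v∈P last~a closed with rotate G linked last~a v∈P
    ... | []       , v↭P  , _ with () ← ↭-length v↭P
    ... | b′ ∷ ps′ , P′↭P , linked′ =
      headChord⇒⊥ path′ short′ r′ (closed′ (here refl)) (closed′ c′∈P′)
                  (∃neighbour∉ G (b′ ∷ _ ∷ []) deg-v)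
      where
      path′ : IsPath G (v ∷ b′ ∷ ps′)
      path′ = Unique-resp-↭ (↭-sym P′↭P) unique , linked′
      r′ : Reversal G v b′ ps′
      r′ = reversal-of G path′
      closed′ : ∀ {x} → x ∈ v ∷ b′ ∷ ps′ → Closed G x (v ∷ b′ ∷ ps′)
      closed′ x∈ = Closed-resp-↭ G (↭-sym P′↭P) (closed (∈-resp-↭ P′↭P x∈))
      c′∈P′ : Reversal.c r′ ∈ v ∷ b′ ∷ ps′
      c′∈P′ = subst (_∈ v ∷ b′ ∷ ps′) (sym (Reversal.head≡last r′)) (lastOf-∈ G v (b′ ∷ ps′))
      short′ : length (b′ ∷ ps′) ≤ g
      short′ = subst (_≤ g) (sym (suc-injective (↭-length P′↭P))) short

    -- Without a chord at either end, a is adjacent only to b and c, so P closes up into a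
    -- cycle with no exits, and rotating it to start at v (degree ≥ 3) produces a chord.
    stuck⇒⊥ : ∀ {a b ps} → IsPath G (a ∷ b ∷ ps) → length (b ∷ ps) ≤ g → v ∈ a ∷ b ∷ ps →
              Stuck G a (b ∷ ps) → ⊥
    stuck⇒⊥ {a} {b} {ps} path short v∈P stuck = withReversal (reversal-of G path)
      where
      open Stuck stuck
      closed-at : ∀ {c} → c ≡ lastOf G a (b ∷ ps) → Closed G c (a ∷ b ∷ ps)
      closed-at refl = last-closed
      withReversal : Reversal G a b ps → ⊥
      withReversal r@(reversal {c} {d} path′ ↭P c≡last _) with escape? G a (b ∷ c ∷ []) | escape? G c (d ∷ a ∷ [])
      ... | yes escape | _          = headChord⇒⊥ path short r head-closed (closed-at c≡last) escape
      ... | no _       | yes escape =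
        headChord⇒⊥ path′ short′ (reversal-sym G path r)
          (Closed-resp-↭ G (↭-sym ↭P) (closed-at c≡last)) (Closed-resp-↭ G (↭-sym ↭P) head-closed) escape
        where
        short′ : length (d ∷ Reversal.rs r) ≤ g
        short′ = subst (_≤ g) (sym (suc-injective (↭-length ↭P))) short
      ... | no ¬escape | no _ = closedCycle⇒⊥ path short v∈P last~a (cycle-closed last~a)
        where
        a~c : Adj G a c
        a~c with ∃neighbour∉ G (b ∷ []) (noLeaf (Linked.head (proj₂ path)))
        ... | w , a~w , w∉[b] with ¬Escape⇒Closed G ¬escape a~w
        ...   | here w≡b          = ⊥-elim (w∉[b] (here w≡b))
        ...   | there (here refl) = a~w
        last~a : Adj G (lastOf G a (b ∷ ps)) a
        last~a = subst (λ x → Adj G x a) c≡last (Adj-sym G a~c)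

    grow : ∀ fuel {a b ps} → IsPath G (a ∷ b ∷ ps) → v ∈ a ∷ b ∷ ps → g ≤ fuel + length ps →
           LongPath G (suc g)
    grow fuel {a} {b} {ps} path v∈P enough with g ≤? length ps
    ... | yes long = a ∷ b ∷ ps , path , s≤s (s≤s long)
    ... | no ¬long with extend G path | fuel
    ...   | inj₂ stuck                       | _         = ⊥-elim (stuck⇒⊥ path (≰⇒> ¬long) v∈P stuck)
    ...   | inj₁ _                           | zero      = ⊥-elim (¬long enough)
    ...   | inj₁ (extension path′ ⊇P longer) | suc fuel′ =
      grow fuel′ path′ (⊇P v∈P) (subst (g ≤_) (trans (sym (+-suc fuel′ _)) (cong (fuel′ +_) (sym longer))) enough)

    longPath-through : LongPath G (suc g)
    longPath-through with ∃neighbour∉ G [] (≤-trans (s≤s z≤n) deg-v)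
    ... | w , v~w , _ =
      grow g ((Adj⇒≢ G v~w ∷ []) ∷ [] ∷ [] , v~w ∷ [-]) (here refl) (≤-reflexive (sym (+-identityʳ g)))

longPath⊎sparse : ∀ {n g} (G : Graph n) → BicycleFree G g → LongPath G (suc g) ⊎ edgeCount G ≤ nonIsolated G
longPath⊎sparse {n} {g} = edgeInduction Motive inductive-step
  where
  Motive : Graph n → Set
  Motive G = BicycleFree G g → LongPath G (suc g) ⊎ edgeCount G ≤ nonIsolated G
  inductive-step : ∀ G → (∀ {H} → edgeCount H < edgeCount G → Motive H) → Motive G
  inductive-step G rec bicycleFree with any? (λ u → deg G u ≟ℕ 1)
  ... | yes (u , deg≡1) with ∃neighbour∉ G [] (≤-reflexive (sym deg≡1))
  ...   | w , u~w , _ with rec (≤-reflexive (sym (edgeCount-removeEdge G u~w)))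
                           (BicycleFree-⊒ (removeEdge-⊑ G u w) bicycleFree)
  ...     | inj₁ long   = inj₁ (LongPath-⊑ (removeEdge-⊑ G u w) long)
  ...     | inj₂ sparse = inj₂ (begin
            edgeCount G                           ≡⟨ edgeCount-removeEdge G u~w ⟩
            suc (edgeCount (removeEdge G u w))    ≤⟨ s≤s sparse ⟩
            suc (nonIsolated (removeEdge G u w))  ≤⟨ nonIsolated-removeLeaf G u~w deg≡1 ⟩
            nonIsolated G                         ∎)
    where open ≤-Reasoning
  inductive-step G rec bicycleFree | no noLeaf with any? (λ v → 3 ≤? deg G v)
  ... | yes (v , deg-v) = inj₁ (longPath-through G bicycleFree deg≥2 deg-v)
    where
    deg≥2 : ∀ {x w} → Adj G x w → 2 ≤ deg G x
    deg≥2 {x} x~w = ≤∧≢⇒< (Adj⇒1≤deg G x~w) (λ 1≡deg → noLeaf (x , sym 1≡deg))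
  ... | no noDeg3 = inj₂ (maxDeg≤2⇒edgeCount≤nonIsolated G (λ i → ≮⇒≥ (λ 2<deg → noDeg3 (i , 2<deg))))

bicycleFree⇒longPath : ∀ {n g} (G : Graph n) → BicycleFree G g → n < edgeCount G → LongPath G (suc g)
bicycleFree⇒longPath G bicycleFree n<m with longPath⊎sparse G bicycleFree
... | inj₁ long   = long
... | inj₂ sparse = ⊥-elim (<⇒≱ n<m (≤-trans sparse (nonIsolated≤n G)))

-- Counting L–L paths

module _ {n} (G : Graph n) where

  orient : List (Fin n) → List (Fin n)
  orient []       = []
  orient (x ∷ xs) = if toℕ x ≤ᵇ toℕ (lastOf G x xs) then x ∷ xs else reverse (x ∷ xs)

  length-orient : ∀ p → length (orient p) ≡ length p
  length-orient []       = refl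
  length-orient (x ∷ xs) with toℕ x ≤ᵇ toℕ (lastOf G x xs)
  ... | true  = refl
  ... | false = length-reverse (x ∷ xs)

  Linked-orient⁻ : ∀ (H : Graph n) p → Linked (Adj H) (orient p) → Linked (Adj H) p
  Linked-orient⁻ H []       linked = linked
  Linked-orient⁻ H (x ∷ xs) linked with toℕ x ≤ᵇ toℕ (lastOf G x xs)
  ... | true  = linked
  ... | false = subst (Linked (Adj H)) (reverse-involutive (x ∷ xs)) (Linked-reverse (Adj-sym H) linked)

  orient-IsLLPath : ∀ {side ℓ x xs} → IsPath G (x ∷ xs) → length xs ≤ ℓ →
                    T (side x) → T (side (lastOf G x xs)) →
                    IsLLPath G side ℓ (orient (x ∷ xs))
  orient-IsLLPath {side} {ℓ} {x} {xs} (unique , linked) short x∈L last∈L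
    with toℕ x ≤ᵇ toℕ (lastOf G x xs) in x≤ᵇlast
  ... | true  = unique , linked , s≤s short , x∈L , last∈L , ≤ᵇ⇒≤ _ _ (subst T (sym x≤ᵇlast) tt)
  ... | false with reverse-∷ G x xs
  ...   | c , cs , rev≡ , refl , last≡x =
    subst (IsLLPath G side ℓ) (sym rev≡)
      ( subst Unique rev≡ (Unique-resp-↭ (↭-sym (↭-reverse (x ∷ xs))) unique)
      , subst (Linked (Adj G)) rev≡ (Linked-reverse (Adj-sym G) linked)
      , subst (_≤ suc ℓ) (trans (sym (length-reverse (x ∷ xs))) (cong length rev≡)) (s≤s short)
      , last∈L , subst (T ∘ side) (sym last≡x) x∈L
      , subst (λ y → toℕ (lastOf G x xs) ≤ toℕ y) (sym last≡x)
              (<⇒≤ (≰⇒> λ x≤last → subst T x≤ᵇlast (≤⇒≤ᵇ x≤last))))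

module _ {n} (G : Graph n) {side : Fin n → Bool} (bipartite : IsBipartition G side) where

  side-lastOf : ∀ m {x} xs → Linked (Adj G) (x ∷ xs) → length xs ≡ 2 * m → side (lastOf G x xs) ≡ side x
  side-lastOf zero    []           _                      _   = refl
  side-lastOf (suc m) {x} (y ∷ z ∷ zs) (x~y ∷ y~z ∷ linked) len = begin
    side (lastOf G z zs)  ≡⟨ side-lastOf m zs linked (suc-injective (suc-injective (trans len (*-suc 2 m)))) ⟩
    side z                ≡⟨ bipartite z y (Adj-sym G y~z) ⟩
    not (side y)          ≡⟨ cong not (bipartite y x (Adj-sym G x~y)) ⟩
    not (not (side x))    ≡⟨ not-involutive (side x) ⟩
    side x                ∎
    where open ≡-Reasoning
  side-lastOf (suc m) (y ∷ []) _ len with () ← suc-injective (trans len (*-suc 2 m))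

  module EvenPrefixes {k y₀ y₁ ys} (path : IsPath G (y₀ ∷ y₁ ∷ ys)) (y₀∈L : T (side y₀))
                      (long : 2 * k ≤ length (y₁ ∷ ys)) where

    prefix-tail : Fin k → List (Fin n)
    prefix-tail j = take (2 * suc (toℕ j)) (y₁ ∷ ys)

    prefix : Fin k → List (Fin n)
    prefix j = y₀ ∷ prefix-tail j

    length-prefix-tail : ∀ j → length (prefix-tail j) ≡ 2 * suc (toℕ j)
    length-prefix-tail j = trans (length-take _ (y₁ ∷ ys)) (m≤n⇒m⊓n≡m (≤-trans (*-monoʳ-≤ 2 (toℕ<n j)) long))

    prefix-path : ∀ j → IsPath G (prefix j)
    prefix-path j = UniqueP.take⁺ _ (proj₁ path) , Linked-take (suc (2 * suc (toℕ j))) (proj₂ path)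

    evenPrefixes : List (List (Fin n))
    evenPrefixes = tabulate (orient G ∘ prefix)

    evenPrefixes-LLPath : All (IsLLPath G side (2 * k)) evenPrefixes
    evenPrefixes-LLPath = AllP.tabulate⁺ λ j →
      orient-IsLLPath G (prefix-path j) (≤-trans (≤-reflexive (length-prefix-tail j)) (*-monoʳ-≤ 2 (toℕ<n j))) y₀∈L
        (subst T (sym (side-lastOf (suc (toℕ j)) _ (proj₂ (prefix-path j)) (length-prefix-tail j))) y₀∈L)

    evenPrefixes-unique : Unique evenPrefixes
    evenPrefixes-unique = UniqueP.tabulate⁺ λ {i} {j} same →
      toℕ-injective (suc-injective (*-cancelˡ-≡ _ _ 2 (suc-injective (begin
        suc (2 * suc (toℕ i))         ≡⟨ cong suc (length-prefix-tail i) ⟨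
        length (prefix i)             ≡⟨ length-orient G (prefix i) ⟨
        length (orient G (prefix i))  ≡⟨ cong length same ⟩
        length (orient G (prefix j))  ≡⟨ length-orient G (prefix j) ⟩
        length (prefix j)             ≡⟨ cong suc (length-prefix-tail j) ⟩
        suc (2 * suc (toℕ j))         ∎))))
      where open ≡-Reasoning

    evenPrefix-¬Linked-removeEdge : ∀ {p} → p ∈ evenPrefixes → ¬ Linked (Adj (removeEdge G y₀ y₁)) p
    evenPrefix-¬Linked-removeEdge p∈ linked′ with ∈-tabulate⁻ p∈
    ... | j , refl = removeEdge-¬Adj G y₀ y₁ (Linked.head (Linked-orient⁻ G (removeEdge G y₀ y₁) (prefix j) linked′))

record Anchored {n} (G : Graph n) (side : Fin n → Bool) (ℓ : ℕ) : Set where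
  constructor anchored
  field
    {y₀ y₁} : Fin n
    {ys}    : List (Fin n)
    path    : IsPath G (y₀ ∷ y₁ ∷ ys)
    y₀∈L    : T (side y₀)
    long    : ℓ ≤ length (y₁ ∷ ys)

anchor : ∀ {n} (G : Graph n) {side ℓ} → IsBipartition G side → 1 ≤ ℓ → LongPath G (suc ℓ) → Anchored G side ℓ
anchor G {side} bipartite 1≤ℓ (x₀ ∷ x₁ ∷ xs , (unique , linked) , s≤s (s≤s long)) with side x₀ in x₀-side | xs
... | true  | _        = anchored (unique , linked) (subst T (sym x₀-side) tt) (m≤n⇒m≤1+n long)
... | false | []       = ⊥-elim (<⇒≱ 1≤ℓ long)
... | false | x₂ ∷ xs′ with unique | linked
...   | _ ∷ unique′ | x₀~x₁ ∷ linked′ =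
  anchored (unique′ , linked′) (subst T (sym (trans (bipartite x₁ x₀ (Adj-sym G x₀~x₁)) (cong not x₀-side))) tt) long

LLPathFamily : ∀ {n} → Graph n → (Fin n → Bool) → ℕ → Set
LLPathFamily {n} G side k =
  Σ (List (List (Fin n))) λ ps → Unique ps × All (IsLLPath G side (2 * k)) ps × k * (edgeCount G ∸ n) ≤ length ps

llPathFamily : ∀ {n g} k → 2 * k ≤ g → (side : Fin n → Bool) (G : Graph n) →
               IsBipartition G side → BicycleFree G g → LLPathFamily G side k
llPathFamily zero     _    _    _ _ _ = [] , [] , [] , z≤n
llPathFamily {n} {g} (suc k′) 2k≤g side = edgeInduction Motive inductive-step
  where
  k : ℕ
  k = suc k′
  Motive : Graph n → Set
  Motive G = IsBipartition G side → BicycleFree G g → LLPathFamily G side k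
  inductive-step : ∀ G → (∀ {H} → edgeCount H < edgeCount G → Motive H) → Motive G
  inductive-step G rec bipartite bicycleFree with edgeCount G ≤? n
  ... | yes sparse = [] , [] , [] , ≤-reflexive (trans (cong (k *_) (m≤n⇒m∸n≡0 sparse)) (*-zeroʳ k))
  ... | no dense
    with anchor G {ℓ = 2 * k} bipartite (≤-trans (s≤s z≤n) (*-monoʳ-≤ 2 (s≤s (z≤n {k′}))))
                (LongPath-mono {G = G} (s≤s 2k≤g) (bicycleFree⇒longPath G bicycleFree (≰⇒> dense)))
  ... | anchored {y₀} {y₁} path y₀∈L long
    with rec (≤-reflexive (sym (edgeCount-removeEdge G (Linked.head (proj₂ path)))))
             (IsBipartition-⊒ (removeEdge-⊑ G y₀ y₁) bipartite) (BicycleFree-⊒ (removeEdge-⊑ G y₀ y₁) bicycleFree)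
  ... | ps′ , unique′ , llPaths′ , bound′ =
    evenPrefixes ++ ps′ ,
    UniqueP.++⁺ evenPrefixes-unique unique′
      (λ (p∈E , p∈ps′) → evenPrefix-¬Linked-removeEdge p∈E (proj₁ (proj₂ (All.lookup llPaths′ p∈ps′)))) ,
    AllP.++⁺ evenPrefixes-LLPath (All.map (IsLLPath-⊑ (removeEdge-⊑ G y₀ y₁)) llPaths′) ,
    bound
    where
    open EvenPrefixes G bipartite {k} path y₀∈L long
    G′ : Graph n
    G′ = removeEdge G y₀ y₁
    m≡1+m′ : edgeCount G ≡ suc (edgeCount G′)
    m≡1+m′ = edgeCount-removeEdge G (Linked.head (proj₂ path))
    n≤m′ : n ≤ edgeCount G′
    n≤m′ = ≤-pred (subst (n <_) m≡1+m′ (≰⇒> dense))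
    bound : k * (edgeCount G ∸ n) ≤ length (evenPrefixes ++ ps′)
    bound = begin
      k * (edgeCount G ∸ n)             ≡⟨ cong (λ m → k * (m ∸ n)) m≡1+m′ ⟩
      k * (suc (edgeCount G′) ∸ n)      ≡⟨ cong (k *_) (+-∸-assoc 1 n≤m′) ⟩
      k * suc (edgeCount G′ ∸ n)        ≡⟨ *-suc k _ ⟩
      k + k * (edgeCount G′ ∸ n)        ≤⟨ +-monoʳ-≤ k bound′ ⟩
      k + length ps′                    ≡⟨ cong (_+ length ps′) (length-tabulate (orient G ∘ prefix)) ⟨
      length evenPrefixes + length ps′  ≡⟨ length-++ evenPrefixes ⟨
      length (evenPrefixes ++ ps′)      ∎
      where open ≤-Reasoning

mainTheorem14 : (g k n : ℕ) → 1 ≤ g → k ≤ g / 2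
    → (G : Graph n) → (side : Fin n → Bool) → IsBipartition G side
    → BicycleFree G g
    → Σ (List (List (Fin n))) (λ ps →
        Unique ps × All (IsLLPath G side (2 * k)) ps
        × k * (edgeCount G ∸ n) ≤ length ps)
mainTheorem14 g k n _ k≤g/2 G side = llPathFamily k 2k≤g side G
  where
  2k≤g : 2 * k ≤ g
  2k≤g = ≤-trans (*-monoʳ-≤ 2 k≤g/2) (subst (_≤ g) (*-comm (g / 2) 2) (m/n*n≤m g 2))
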